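{- Let $k\geqslant 2$ be an integer and $\kappa$ the sequence defined in the context. If $n\geqslant 1$ and $a,b\in\{0,\ldots,k-1\}$, then $$\kappa(k^2n+kb+a)=(a+1)\kappa(kn+b)+\kappa(n).$$
   Context: Fix an integer $k\geqslant 2$. For $i\in\{0,1,\ldots,k-1\}$ let $\mathbf{A}_i=\begin{pmatrix} i+1&1\\ 1&0\end{pmatrix}$. For an integer $n\geqslant 0$ with standard base-$k$ expansion $(n)_k=i_s\cdots i_1i_0$ (no leading zeros; the empty word for $n=0$), define $\kappa(n)=[1\ 0]\,\mathbf{A}_{i_0}\mathbf{A}_{i_1}\cdots\mathbf{A}_{i_s}\,[1\ 0]^T$, the empty product being the identity matrix. -}

module Defs where

open import Data.Nat using (ℕ; zero; suc; _+_; _*_; NonZero)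
open import Data.Nat.DivMod using (_/_; _%_)
open import Data.List using (List; []; _∷_)

record Mat : Set where
  constructor mat
  field
    a b c d : ℕ

_⊗_ : Mat → Mat → Mat
mat a b c d ⊗ mat a' b' c' d' =
  mat (a * a' + b * c') (a * b' + b * d') (c * a' + d * c') (c * b' + d * d')

I₂ : Mat
I₂ = mat 1 0 0 1

A : ℕ → Mat
A i = mat (suc i) 1 1 0

-- base-k digits, least significant first (i₀ ∷ i₁ ∷ … ∷ i_s), standard expansion
-- (no leading zeros; empty list for n = 0).  The fuel argument is ≥ number of digits
-- when it equals n (k ≥ 2), so  digits k n  uses fuel n.
digitsF : (k : ℕ) → .{{_ : NonZero k}} → ℕ → ℕ → List ℕ
digitsF k zero    n       = []
digitsF k (suc f) zero    = []
digitsF k (suc f) (suc n) = (suc n % k) ∷ digitsF k f (suc n / k)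

digits : (k : ℕ) → .{{_ : NonZero k}} → ℕ → List ℕ
digits k n = digitsF k n n

prodA : List ℕ → Mat
prodA []       = I₂
prodA (i ∷ is) = A i ⊗ prodA is

-- κ(n) = [1 0] A_{i₀} ⋯ A_{i_s} [1 0]^T  = top-left entry
κ : (k : ℕ) → .{{_ : NonZero k}} → ℕ → ℕ
κ k n = Mat.a (prodA (digits k n))

module Submission where

-- Writing  N = k²n + kb + a = k(kn + b) + a  with digits a, b < k and n ≥ 1,
-- the standard base-k expansion of N is that of n followed by the two least
-- significant digits b and a.  Since κ reads the digits least significant
-- first,  prodA (digits k N) = A_a · A_b · P  with  P = prodA (digits k n).
-- The theorem is then the continuant recurrence for the top-left entry of a
-- product  A_i · A_j · P,  applied once.

open import Defs
open import Data.Nat using (ℕ; zero; suc; _+_; _*_; _≤_; _<_; NonZero; >-nonZero; s≤s)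
open import Data.Nat.Properties
open import Data.Nat.DivMod
open import Data.Nat.Divisibility using (n∣m*n)
open import Data.List using ([]; _∷_)
open import Relation.Binary.PropositionalEquality
open ≡-Reasoning

-- For k ≥ 2, dividing a positive number by k strictly decreases it; this is
-- what makes n units of fuel enough to expand n.
quotient-shrinks : (k : ℕ) → .{{_ : NonZero k}} → 2 ≤ k → (n : ℕ) → suc n / k ≤ n
quotient-shrinks k k≥2 n = ≤-pred (m/n<m (suc n) k k≥2)

digitsF-zero : (k : ℕ) → .{{_ : NonZero k}} → (f : ℕ) → digitsF k f 0 ≡ []
digitsF-zero k zero    = refl
digitsF-zero k (suc f) = refl

digitsF-fuel : (k : ℕ) → .{{_ : NonZero k}} → 2 ≤ k → (f g n : ℕ) → n ≤ f → n ≤ g →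
  digitsF k f n ≡ digitsF k g n
digitsF-fuel k _ f g zero _ _ = trans (digitsF-zero k f) (sym (digitsF-zero k g))
digitsF-fuel k k≥2 (suc f) (suc g) (suc n) (s≤s n≤f) (s≤s n≤g) =
  cong (suc n % k ∷_) (digitsF-fuel k k≥2 f g (suc n / k) (≤-trans quot≤n n≤f) (≤-trans quot≤n n≤g))
  where
  quot≤n : suc n / k ≤ n
  quot≤n = quotient-shrinks k k≥2 n

digits-unfold : (k : ℕ) → .{{_ : NonZero k}} → 2 ≤ k → (x : ℕ) → .{{_ : NonZero x}} →
  digits k x ≡ x % k ∷ digits k (x / k)
digits-unfold k k≥2 (suc x) =
  cong (suc x % k ∷_) (digitsF-fuel k k≥2 x (suc x / k) (suc x / k) (quotient-shrinks k k≥2 x) ≤-refl)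

-- Euclidean division of  k·m + a  by k when a is a digit: quotient m,
-- remainder a.  The library states division facts for the form  a + m·k.
digit-split : (k m a : ℕ) → k * m + a ≡ a + m * k
digit-split k m a = trans (+-comm (k * m) a) (cong (a +_) (*-comm k m))

div-digit : (k : ℕ) → .{{_ : NonZero k}} → (m a : ℕ) → a < k → (k * m + a) / k ≡ m
div-digit k m a a<k = begin
  (k * m + a) / k      ≡⟨ cong (_/ k) (digit-split k m a) ⟩
  (a + m * k) / k      ≡⟨ +-distrib-/-∣ʳ a (n∣m*n m) ⟩
  a / k + m * k / k    ≡⟨ cong₂ _+_ (m<n⇒m/n≡0 a<k) (m*n/n≡m m k) ⟩
  m                    ∎

mod-digit : (k : ℕ) → .{{_ : NonZero k}} → (m a : ℕ) → a < k → (k * m + a) % k ≡ a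
mod-digit k m a a<k = begin
  (k * m + a) % k      ≡⟨ cong (_% k) (digit-split k m a) ⟩
  (a + m * k) % k      ≡⟨ [m+kn]%n≡m%n a m k ⟩
  a % k                ≡⟨ m<n⇒m%n≡m a<k ⟩
  a                    ∎

-- Appending the digit a to the expansion of a positive m gives the expansion
-- of k·m + a (positivity of m rules out a leading zero).
digits-step : (k : ℕ) → .{{_ : NonZero k}} → 2 ≤ k → (m a : ℕ) → 1 ≤ m → a < k →
  digits k (k * m + a) ≡ a ∷ digits k m
digits-step k k≥2 m a m≥1 a<k = begin
  digits k (k * m + a)
    ≡⟨ digits-unfold k k≥2 (k * m + a) {{>-nonZero km+a≥1}} ⟩
  (k * m + a) % k ∷ digits k ((k * m + a) / k)
    ≡⟨ cong₂ (λ d q → d ∷ digits k q) (mod-digit k m a a<k) (div-digit k m a a<k) ⟩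
  a ∷ digits k m ∎
  where
  km+a≥1 : 1 ≤ k * m + a
  km+a≥1 = ≤-trans (≤-trans m≥1 (m≤n*m m k)) (m≤m+n (k * m) a)

A⊗-topLeft : (i : ℕ) (P : Mat) → Mat.a (A i ⊗ P) ≡ suc i * Mat.a P + Mat.c P
A⊗-topLeft i (mat p q r s) = cong (suc i * p +_) (*-identityˡ r)

A⊗-bottomLeft : (i : ℕ) (P : Mat) → Mat.c (A i ⊗ P) ≡ Mat.a P
A⊗-bottomLeft i (mat p q r s) = trans (+-identityʳ (1 * p)) (*-identityˡ p)

continuant : (i j : ℕ) (P : Mat) →
  Mat.a (A i ⊗ (A j ⊗ P)) ≡ suc i * Mat.a (A j ⊗ P) + Mat.a P
continuant i j P =
  trans (A⊗-topLeft i (A j ⊗ P)) (cong (suc i * Mat.a (A j ⊗ P) +_) (A⊗-bottomLeft j P))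

lemma7 : (k : ℕ) → .{{_ : NonZero k}} → 2 ≤ k → (n a b : ℕ) → 1 ≤ n → a < k → b < k →
    κ k (k * k * n + k * b + a) ≡ suc a * κ k (k * n + b) + κ k n
lemma7 k k≥2 n a b n≥1 a<k b<k = begin
  κ k (k * k * n + k * b + a)
    ≡⟨ cong (λ x → κ k (x + a)) regroup ⟩
  κ k (k * (k * n + b) + a)
    ≡⟨ cong (λ ds → Mat.a (prodA ds)) (digits-step k k≥2 (k * n + b) a kn+b≥1 a<k) ⟩
  Mat.a (A a ⊗ prodA (digits k (k * n + b)))
    ≡⟨ cong (λ ds → Mat.a (A a ⊗ prodA ds)) lastDigit-b ⟩
  Mat.a (A a ⊗ (A b ⊗ prodA (digits k n)))
    ≡⟨ continuant a b (prodA (digits k n)) ⟩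
  suc a * Mat.a (A b ⊗ prodA (digits k n)) + κ k n
    ≡⟨ cong (λ ds → suc a * Mat.a (prodA ds) + κ k n) (sym lastDigit-b) ⟩
  suc a * κ k (k * n + b) + κ k n ∎
  where
  regroup : k * k * n + k * b ≡ k * (k * n + b)
  regroup = trans (cong (_+ k * b) (*-assoc k k n)) (sym (*-distribˡ-+ k (k * n) b))
  kn+b≥1 : 1 ≤ k * n + b
  kn+b≥1 = ≤-trans (≤-trans n≥1 (m≤n*m n k)) (m≤m+n (k * n) b)
  lastDigit-b : digits k (k * n + b) ≡ b ∷ digits k n
  lastDigit-b = digits-step k k≥2 n b n≥1 b<k
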